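{- Let $\mathsf{D}$ be an optiongraph and let $\mathsf{C}$ be a suboptiongraph of $\mathsf{D}$. Then $\mathsf{C}/{\bowtie_{\mathsf{C}}}$ is isomorphic to a suboptiongraph of $\mathsf{D}/{\bowtie_{\mathsf{D}}}$.
   Context: An optiongraph is a nonempty set $\mathsf{D}$ (of positions, possibly infinite) together with an option function $\mathrm{Opt}_{\mathsf{D}}:\mathsf{D}\to 2^{\mathsf{D}}$. A function $f:\mathsf{C}\to\mathsf{D}$ is option preserving if $\mathrm{Opt}_{\mathsf{D}}(f(p))=f(\mathrm{Opt}_{\mathsf{C}}(p))$ for all $p$; an isomorphism is a bijective option-preserving map. A suboptiongraph of $\mathsf{D}$ is a nonempty subset $\mathsf{C}\subseteq\mathsf{D}$ with option function such that the inclusion map is option preserving. For an equivalence relation $\theta$, write $[p]$ for the class of $p$ and $[S]:=\{[s]\mid s\in S\}$. An equivalence relation on an optiongraph is a congruence relation if $p\mathrel{\theta}q$ implies $[\mathrm{Opt}(p)]=[\mathrm{Opt}(q)]$. The union $\bowtie_{\mathsf{D}}$ of all congruence relations on $\mathsf{D}$ is itself a congruence relation (the maximum one). For a congruence relation $\theta$, the quotient optiongraph $\mathsf{D}/\theta$ is the set of classes with option function $\mathrm{Opt}_{\mathsf{D}/\theta}([p]):=[\mathrm{Opt}_{\mathsf{D}}(p)]$. -}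

module Defs where

open import Level using (Level; _⊔_; suc; Lift; lift; lower)
open import Data.Product using (Σ; ∃; _×_; _,_; proj₁; proj₂)
open import Data.Sum using (_⊎_; inj₁; inj₂)
open import Relation.Unary using (Pred; _∈_)
open import Relation.Binary using (Rel; IsEquivalence)
open import Relation.Binary.Construct.Closure.ReflexiveTransitive
  using (Star; ε; _◅_; _◅◅_; reverse)

-- Setoid-style modelling: a "set" is a type with an equivalence _≈_
-- (take _≈_ = _≡_ for a plain set); a quotient by θ is the same
-- carrier with equality θ.  Subsets are predicates.

-- [S]_R = [T]_R : every element of S is R-related to one of T and
-- vice versa (equality of the sets of R-classes).
_≐[_]_ : ∀ {a r p q} {A : Set a} → Pred A p → Rel A r → Pred A q → Set _
S ≐[ R ] T = (∀ {x} → x ∈ S → ∃ λ y → y ∈ T × R x y)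
           × (∀ {y} → y ∈ T → ∃ λ x → x ∈ S × R x y)

image : ∀ {a b e p} {A : Set a} {B : Set b} (_≈_ : Rel B e) →
        (A → B) → Pred A p → Pred B (a ⊔ e ⊔ p)
image _≈_ f S y = ∃ λ x → x ∈ S × (f x ≈ y)

record Optiongraph (a e p : Level) : Set (suc (a ⊔ e ⊔ p)) where
  field
    Carrier       : Set a
    _≈_           : Rel Carrier e
    isEquivalence : IsEquivalence _≈_
    point         : Carrier
    Opt           : Carrier → Pred Carrier p
    Opt-resp      : ∀ {x y} → x ≈ y → Opt x ≐[ _≈_ ] Opt y

open Optiongraph

OptionPreserving : ∀ {a e p b e' p'} (C : Optiongraph a e p) (D : Optiongraph b e' p') →
                   (Carrier C → Carrier D) → Set _
OptionPreserving C D f =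
  ∀ x → Opt D (f x) ≐[ _≈_ D ] image (_≈_ D) f (Opt C x)

record Isomorphism {a e p b e' p'} (C : Optiongraph a e p) (D : Optiongraph b e' p')
       : Set (a ⊔ e ⊔ p ⊔ b ⊔ e' ⊔ p') where
  field
    fun        : Carrier C → Carrier D
    fun-resp   : ∀ {x y} → _≈_ C x y → _≈_ D (fun x) (fun y)
    injective  : ∀ {x y} → _≈_ D (fun x) (fun y) → _≈_ C x y
    surjective : ∀ y → ∃ λ x → _≈_ D (fun x) y
    preserving : OptionPreserving C D fun

_≅_ : ∀ {a e p b e' p'} → Optiongraph a e p → Optiongraph b e' p' → Set _
C ≅ D = Isomorphism C D

record Suboptiongraph {a e p} (D : Optiongraph a e p) (s : Level)
       : Set (a ⊔ e ⊔ suc p ⊔ suc s) where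
  field
    Pos      : Pred (Carrier D) s
    nonempty : ∃ λ x → x ∈ Pos
    OptC     : Σ (Carrier D) Pos → Pred (Σ (Carrier D) Pos) p
    incl-preserving : ∀ (x : Σ (Carrier D) Pos) →
      Opt D (proj₁ x) ≐[ _≈_ D ] image (_≈_ D) proj₁ (OptC x)

module _ {a e p} {D : Optiongraph a e p} where
  private
    module D = Optiongraph D
    module E = IsEquivalence D.isEquivalence

  -- the suboptiongraph viewed as an optiongraph (its well-definedness
  -- is derived from option preservation of the inclusion)
  toOptiongraph : ∀ {s} → Suboptiongraph D s → Optiongraph (a ⊔ s) e p
  toOptiongraph {s} C = record
    { Carrier = Σ D.Carrier C.Pos
    ; _≈_ = λ x y → proj₁ x D.≈ proj₁ y
    ; isEquivalence = record { refl = E.refl ; sym = E.sym ; trans = E.trans }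
    ; point = C.nonempty
    ; Opt = C.OptC
    ; Opt-resp = λ {x} {y} x≈y → resp x y x≈y , λ v∈ →
        let (u , u∈ , r) = resp y x (E.sym x≈y) v∈ in u , u∈ , E.sym r
    }
    where
    module C = Suboptiongraph C
    resp : ∀ x y → proj₁ x D.≈ proj₁ y → ∀ {u} → u ∈ C.OptC x →
           ∃ λ v → v ∈ C.OptC y × (proj₁ u D.≈ proj₁ v)
    resp x y x≈y {u} u∈ =
      let (w , w∈ , w≈u) = proj₂ (C.incl-preserving x) (u , u∈ , E.refl)
          (w' , w'∈ , w≈w') = proj₁ (D.Opt-resp x≈y) w∈
          (v' , (v , v∈ , v≈v') , w'≈v') = proj₁ (C.incl-preserving y) w'∈
      in v , v∈ , E.trans (E.sym w≈u) (E.trans w≈w' (E.trans w'≈v' (E.sym v≈v')))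

record IsCongruence {a e p r} (D : Optiongraph a e p) (θ : Rel (Carrier D) r)
       : Set (a ⊔ e ⊔ p ⊔ r) where
  field
    isEquivalence : IsEquivalence θ
    ≈⊆θ           : ∀ {x y} → _≈_ D x y → θ x y
    cong          : ∀ {x y} → θ x y → Opt D x ≐[ θ ] Opt D y

_/_ : ∀ {a e p r} (D : Optiongraph a e p) {θ : Rel (Carrier D) r} →
      IsCongruence D θ → Optiongraph a r p
_/_ D {θ} c = record
  { Carrier = Carrier D
  ; _≈_ = θ
  ; isEquivalence = IsCongruence.isEquivalence c
  ; point = point D
  ; Opt = Opt D
  ; Opt-resp = IsCongruence.cong c
  }

-- The maximum congruence ⋈_D : union of all congruence relations
-- (relations living in the universe level a ⊔ e ⊔ p of D).
⋈ : ∀ {a e p} (D : Optiongraph a e p) → Rel (Carrier D) (suc (a ⊔ e ⊔ p))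
⋈ {a} {e} {p} D x y =
  Σ (Rel (Carrier D) (a ⊔ e ⊔ p)) λ θ → IsCongruence D θ × θ x y

private
  ≐-map : ∀ {a r r' p q} {A : Set a} {R : Rel A r} {R' : Rel A r'}
          {S : Pred A p} {T : Pred A q} →
          (∀ {x y} → R x y → R' x y) → S ≐[ R ] T → S ≐[ R' ] T
  ≐-map g (f , b) = (λ x∈ → let (y , y∈ , r) = f x∈ in y , y∈ , g r)
                  , (λ y∈ → let (x , x∈ , r) = b y∈ in x , x∈ , g r)

  ≐-refl : ∀ {a r p} {A : Set a} {R : Rel A r} {S : Pred A p} →
           (∀ {x} → R x x) → S ≐[ R ] S
  ≐-refl rf = (λ {x} x∈ → x , x∈ , rf) , (λ {y} y∈ → y , y∈ , rf)

  ≐-trans : ∀ {a r p q t} {A : Set a} {R : Rel A r} {S : Pred A p}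
            {T : Pred A q} {U : Pred A t} →
            (∀ {x y z} → R x y → R y z → R x z) →
            S ≐[ R ] T → T ≐[ R ] U → S ≐[ R ] U
  ≐-trans tr (f₁ , b₁) (f₂ , b₂) =
      (λ x∈ → let (y , y∈ , r₁) = f₁ x∈ ; (z , z∈ , r₂) = f₂ y∈ in z , z∈ , tr r₁ r₂)
    , (λ z∈ → let (y , y∈ , r₂) = b₂ z∈ ; (x , x∈ , r₁) = b₁ y∈ in x , x∈ , tr r₁ r₂)

module _ {a e p} (D : Optiongraph a e p) where
  private
    module D = Optiongraph D
    module E = IsEquivalence D.isEquivalence
    r = a ⊔ e ⊔ p

  private
    liftCong : IsCongruence D (λ x y → Lift r (x D.≈ y))
    liftCong = record
      { isEquivalence = record
          { refl = lift E.refl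
          ; sym = λ q → lift (E.sym (lower q))
          ; trans = λ q q' → lift (E.trans (lower q) (lower q')) }
      ; ≈⊆θ = lift
      ; cong = λ q → ≐-map lift (D.Opt-resp (lower q)) }

    joinCong : ∀ {θ₁ θ₂ : Rel D.Carrier r} → IsCongruence D θ₁ → IsCongruence D θ₂ →
               IsCongruence D (Star (λ x y → θ₁ x y ⊎ θ₂ x y))
    joinCong {θ₁} {θ₂} c₁ c₂ = record
      { isEquivalence = record
          { refl = ε
          ; sym = reverse symU
          ; trans = _◅◅_ }
      ; ≈⊆θ = λ q → inj₁ (C₁.≈⊆θ q) ◅ ε
      ; cong = congS }
      where
      module C₁ = IsCongruence c₁
      module C₂ = IsCongruence c₂
      U : Rel D.Carrier r
      U x y = θ₁ x y ⊎ θ₂ x y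
      symU : ∀ {x y} → U x y → U y x
      symU (inj₁ q) = inj₁ (IsEquivalence.sym C₁.isEquivalence q)
      symU (inj₂ q) = inj₂ (IsEquivalence.sym C₂.isEquivalence q)
      congS : ∀ {x y} → Star U x y → D.Opt x ≐[ Star U ] D.Opt y
      congS ε = ≐-refl ε
      congS (inj₁ q ◅ qs) = ≐-trans _◅◅_ (≐-map (λ t → inj₁ t ◅ ε) (C₁.cong q)) (congS qs)
      congS (inj₂ q ◅ qs) = ≐-trans _◅◅_ (≐-map (λ t → inj₂ t ◅ ε) (C₂.cong q)) (congS qs)

  ⋈-isCongruence : IsCongruence D (⋈ D)
  ⋈-isCongruence = record
    { isEquivalence = record
        { refl = ≈⊆ E.refl
        ; sym = λ { (θ , c , t) → θ , c , IsEquivalence.sym (IsCongruence.isEquivalence c) t }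
        ; trans = λ { (θ₁ , c₁ , t₁) (θ₂ , c₂ , t₂) →
              _ , joinCong c₁ c₂ , (inj₁ t₁ ◅ (inj₂ t₂ ◅ ε)) } }
    ; ≈⊆θ = ≈⊆
    ; cong = λ { (θ , c , t) → ≐-map (λ t' → θ , c , t') (IsCongruence.cong c t) } }
    where
    ≈⊆ : ∀ {x y} → x D.≈ y → ⋈ D x y
    ≈⊆ q = _ , liftCong , lift q

_/⋈ : ∀ {a e p} (D : Optiongraph a e p) → Optiongraph a (suc (a ⊔ e ⊔ p)) p
D /⋈ = D / ⋈-isCongruence D

{-# OPTIONS --safe #-}
module Submission where

-- Option-preserving maps preserve and reflect the maximum congruence: a
-- congruence on D pulls back along f to one on C, and a congruence θ on C
-- pushes forward to the congruence on D generated by ≈ and the f-images of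
-- θ-related pairs (compatible step by step because Opt (f u) is the image of
-- Opt u).  Applied to the inclusion of C into D this says that ⋈_C is the
-- restriction of ⋈_D, so the identity on positions is the isomorphism from
-- C/⋈_C onto C viewed inside D/⋈_D.

open import Defs
open import Level using (Level; _⊔_)
open import Data.Product using (Σ; _,_)
open import Function.Base using (id; _on_)
open import Relation.Unary using (Pred)
open import Relation.Binary using (Rel; IsEquivalence; _⇒_; _=[_]⇒_; Reflexive; Symmetric; Transitive)
open import Relation.Binary.Construct.Closure.ReflexiveTransitive using (ε; _◅_; _◅◅_)
open import Relation.Binary.Construct.Closure.Symmetric using (fwd; bwd)
open import Relation.Binary.Construct.Closure.Equivalence as EqClosure using (EqClosure)

private
  variable
    a b e e′ p p′ q r r′ s t : Level
    A B : Set a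

open Optiongraph using (Carrier; _≈_)

module _ {R : Rel A r} {S : Pred A p} {T : Pred A q} where

  ≐-map : {R′ : Rel A r′} → R ⇒ R′ → S ≐[ R ] T → S ≐[ R′ ] T
  ≐-map g (to , from) =
      (λ x∈ → let (y , y∈ , xRy) = to x∈ in y , y∈ , g xRy)
    , (λ y∈ → let (x , x∈ , xRy) = from y∈ in x , x∈ , g xRy)

  ≐-sym : Symmetric R → S ≐[ R ] T → T ≐[ R ] S
  ≐-sym sym (to , from) =
      (λ y∈ → let (x , x∈ , xRy) = from y∈ in x , x∈ , sym xRy)
    , (λ x∈ → let (y , y∈ , xRy) = to x∈ in y , y∈ , sym xRy)

  ≐-trans : {U : Pred A t} → Transitive R → S ≐[ R ] T → T ≐[ R ] U → S ≐[ R ] U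
  ≐-trans trans (to₁ , from₁) (to₂ , from₂) =
      (λ x∈ → let (y , y∈ , xRy) = to₁ x∈ ; (z , z∈ , yRz) = to₂ y∈ in z , z∈ , trans xRy yRz)
    , (λ z∈ → let (y , y∈ , yRz) = from₂ z∈ ; (x , x∈ , xRy) = from₁ y∈ in x , x∈ , trans xRy yRz)

≐-refl : {R : Rel A r} {S : Pred A p} → Reflexive R → S ≐[ R ] S
≐-refl refl = (λ x∈ → _ , x∈ , refl) , (λ y∈ → _ , y∈ , refl)

≐-image-id : {R : Rel A r} {S : Pred A p} → Reflexive R → S ≐[ R ] image R id S
≐-image-id refl = (λ x∈ → _ , (_ , x∈ , refl) , refl) , (λ (x , x∈ , xRy) → x , x∈ , xRy)

module _ {_≈_ : Rel B e} (≈-isEquivalence : IsEquivalence _≈_) (f : A → B)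
         {R′ : Rel B r′} (≈⇒R′ : _≈_ ⇒ R′) (R′-trans : Transitive R′)
         {S : Pred A p} {T : Pred A q} where

  private module ≈ = IsEquivalence ≈-isEquivalence

  ≐-image⁺ : {R : Rel A r} → R =[ f ]⇒ R′ → S ≐[ R ] T → image _≈_ f S ≐[ R′ ] image _≈_ f T
  ≐-image⁺ R⇒R′ (to , from) =
      (λ (x , x∈ , fx≈y) → let (x′ , x′∈ , xRx′) = to x∈ in
         f x′ , (x′ , x′∈ , ≈.refl) , R′-trans (≈⇒R′ (≈.sym fx≈y)) (R⇒R′ xRx′))
    , (λ (x′ , x′∈ , fx′≈y) → let (x , x∈ , xRx′) = from x′∈ in
         f x , (x , x∈ , ≈.refl) , R′-trans (R⇒R′ xRx′) (≈⇒R′ fx′≈y))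

  ≐-image⁻ : image _≈_ f S ≐[ R′ ] image _≈_ f T → S ≐[ R′ on f ] T
  ≐-image⁻ (to , from) =
      (λ x∈ → let (_ , (x′ , x′∈ , fx′≈y) , fxR′y) = to (_ , x∈ , ≈.refl) in
         x′ , x′∈ , R′-trans fxR′y (≈⇒R′ (≈.sym fx′≈y)))
    , (λ x′∈ → let (_ , (x , x∈ , fx≈y) , yR′fx′) = from (_ , x′∈ , ≈.refl) in
         x , x∈ , R′-trans (≈⇒R′ fx≈y) yR′fx′)

module _ (D : Optiongraph a e p) where

  private module D = Optiongraph D

  eqClosure-isCongruence : {G : Rel (Carrier D) r} → _≈_ D ⇒ G →
                           (∀ {x y} → G x y → D.Opt x ≐[ EqClosure G ] D.Opt y) →
                           IsCongruence D (EqClosure G)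
  eqClosure-isCongruence {G = G} ≈⇒G G-compatible = record
    { isEquivalence = EqClosure.isEquivalence G
    ; ≈⊆θ           = λ x≈y → EqClosure.return (≈⇒G x≈y)
    ; cong          = compatible
    }
    where
    compatible : ∀ {x y} → EqClosure G x y → D.Opt x ≐[ EqClosure G ] D.Opt y
    compatible ε             = ≐-refl ε
    compatible (fwd g ◅ gs) = ≐-trans _◅◅_ (G-compatible g) (compatible gs)
    compatible (bwd g ◅ gs) =
      ≐-trans _◅◅_ (≐-sym (EqClosure.symmetric G) (G-compatible g)) (compatible gs)

data PushforwardStep {A : Set a} {B : Set b} (_≈_ : Rel B e) (f : A → B) (θ : Rel A r) :
                     Rel B (a ⊔ b ⊔ e ⊔ r) where
  ≈-step : ∀ {x y} → x ≈ y → PushforwardStep _≈_ f θ x y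
  θ-step : ∀ {u v} → θ u v → PushforwardStep _≈_ f θ (f u) (f v)

module _ {C : Optiongraph a e p} {D : Optiongraph b e′ p′} {f : Carrier C → Carrier D}
         (f-preserving : OptionPreserving C D f) where

  private
    module D = Optiongraph D
    module ≈D = IsEquivalence D.isEquivalence

  pullback-isCongruence : _≈_ C =[ f ]⇒ _≈_ D → {θ : Rel (Carrier D) r} →
                          IsCongruence D θ → IsCongruence C (θ on f)
  pullback-isCongruence f-resp θ-cong = record
    { isEquivalence = record { refl = Θ.refl ; sym = Θ.sym ; trans = Θ.trans }
    ; ≈⊆θ           = λ x≈y → Θ.≈⊆θ (f-resp x≈y)
    ; cong          = λ {x} {y} fxθfy → ≐-image⁻ D.isEquivalence f Θ.≈⊆θ Θ.trans
        (≐-trans Θ.trans (≐-map Θ.≈⊆θ (≐-sym ≈D.sym (f-preserving x)))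
        (≐-trans Θ.trans (Θ.cong fxθfy)
                         (≐-map Θ.≈⊆θ (f-preserving y))))
    }
    where
    module Θ where
      open IsCongruence θ-cong public
      open IsEquivalence isEquivalence public

  pushforward-isCongruence : {θ : Rel (Carrier C) r} →
                             IsCongruence C θ → IsCongruence D (EqClosure (PushforwardStep D._≈_ f θ))
  pushforward-isCongruence {θ = θ} θ-cong =
    eqClosure-isCongruence D ≈-step step-compatible
    where
    ≈⇒pushforward : D._≈_ ⇒ EqClosure (PushforwardStep D._≈_ f θ)
    ≈⇒pushforward x≈y = EqClosure.return (≈-step x≈y)
    step-compatible : ∀ {x y} → PushforwardStep D._≈_ f θ x y →
                      D.Opt x ≐[ EqClosure (PushforwardStep D._≈_ f θ) ] D.Opt y
    step-compatible (≈-step x≈y) = ≐-map ≈⇒pushforward (D.Opt-resp x≈y)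
    step-compatible (θ-step {u} {v} uθv) =
      ≐-trans _◅◅_ (≐-map ≈⇒pushforward (f-preserving u))
      (≐-trans _◅◅_ (≐-image⁺ D.isEquivalence f ≈⇒pushforward _◅◅_
                       (λ wθw′ → EqClosure.return (θ-step wθw′)) (IsCongruence.cong θ-cong uθv))
                    (≐-map ≈⇒pushforward (≐-sym ≈D.sym (f-preserving v))))

  preserving-into-quotient : {θ : Rel (Carrier D) r} (θ-cong : IsCongruence D θ) →
                             OptionPreserving C (D / θ-cong) f
  preserving-into-quotient θ-cong x = let (to , from) = f-preserving x in
      (λ z∈ → let (y , (w , w∈ , fw≈y) , z≈y) = to z∈ in
         y , (w , w∈ , Θ.≈⊆θ fw≈y) , Θ.≈⊆θ z≈y)
    , (λ (w , w∈ , fwθy) → let (z , z∈ , z≈fw) = from (w , w∈ , ≈D.refl) in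
         z , z∈ , Θ.trans (Θ.≈⊆θ z≈fw) fwθy)
    where
    module Θ where
      open IsCongruence θ-cong public
      open IsEquivalence isEquivalence public

module _ {C D : Optiongraph a e p} {f : Carrier C → Carrier D}
         (f-preserving : OptionPreserving C D f) where

  ⋈-preserved : ∀ {x y} → ⋈ C x y → ⋈ D (f x) (f y)
  ⋈-preserved (θ , θ-cong , xθy) =
    _ , pushforward-isCongruence f-preserving θ-cong , EqClosure.return (θ-step xθy)

  ⋈-reflected : _≈_ C =[ f ]⇒ _≈_ D → ∀ {x y} → ⋈ D (f x) (f y) → ⋈ C x y
  ⋈-reflected f-resp (θ , θ-cong , fxθfy) =
    _ , pullback-isCongruence f-preserving f-resp θ-cong , fxθfy

inQuotient : {D : Optiongraph a e p} → Suboptiongraph D s →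
             {θ : Rel (Carrier D) r} (θ-cong : IsCongruence D θ) → Suboptiongraph (D / θ-cong) s
inQuotient S θ-cong = record
  { Pos             = Pos
  ; nonempty        = nonempty
  ; OptC            = OptC
  ; incl-preserving = preserving-into-quotient {C = toOptiongraph S} incl-preserving θ-cong
  }
  where open Suboptiongraph S

mainTheorem10 : ∀ {a e p : Level} (D : Optiongraph a e p) (C : Suboptiongraph D a) →
    Σ (Suboptiongraph (D /⋈) a) λ S →
      (toOptiongraph C /⋈) ≅ toOptiongraph S
mainTheorem10 D C = inQuotient C (⋈-isCongruence D) , record
  { fun        = id
  ; fun-resp   = ⋈-preserved {C = toOptiongraph C} incl-preserving
  ; injective  = ⋈-reflected {C = toOptiongraph C} incl-preserving id
  ; surjective = λ x → x , ⋈-refl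
  ; preserving = λ _ → ≐-image-id ⋈-refl
  }
  where
  open Suboptiongraph C using (incl-preserving)
  ⋈-refl : Reflexive (⋈ D)
  ⋈-refl = IsEquivalence.refl (IsCongruence.isEquivalence (⋈-isCongruence D))
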